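{- Let $\Gamma$ be a basis, $\delta$ a value type with $\delta\neq\omega_{\mathsf V}$ and $\tau$ a computation type with $\tau\neq\omega_{\mathsf C}$. Then: (1) if $\Gamma\vdash x:\delta$ then $\Gamma(x)\le_{\mathsf V}\delta$; (2) if $\Gamma\vdash\lambda x.M:\delta$ then there exist a finite set $I$ and types $\delta_i,\tau_i$ ($i\in I$) such that $\Gamma,x:\delta_i\vdash M:\tau_i$ for all $i\in I$ and $\bigwedge_{i\in I}(\delta_i\to\tau_i)\le_{\mathsf V}\delta$; (3) if $\Gamma\vdash\mathit{unit}\,V:\tau$ then there exists $\delta'$ with $\Gamma\vdash V:\delta'$ and $T\delta'\le_{\mathsf C}\tau$; (4) if $\Gamma\vdash M\star V:\tau$ then there exist a finite set $I$ and types $\delta_i,\tau_i$ ($i\in I$) such that for all $i\in I$, $\Gamma\vdash M:T\delta_i$ and $\Gamma\vdash V:\delta_i\to\tau_i$, and $\bigwedge_{i\in I}\tau_i\le_{\mathsf C}\tau$.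
   Context: Syntax of $\lambda_c^u$: values $V ::= x\mid \lambda x.M$, computations $M ::= \mathit{unit}\,V\mid M\star V$. Types: value types $\delta ::= \alpha\mid \delta\to\tau\mid \delta\wedge\delta\mid \omega_{\mathsf V}$, computation types $\tau ::= T\delta\mid \tau\wedge\tau\mid \omega_{\mathsf C}$. Preorders $\le_{\mathsf V},\le_{\mathsf C}$: the least preorders such that for each sort $\omega$ is top, $\wedge$ is monotone, idempotent, commutative, $\sigma\wedge\sigma'\le\sigma$, $\sigma\le\sigma',\sigma\le\sigma''\Rightarrow\sigma\le\sigma'\wedge\sigma''$, and $\omega_{\mathsf V}\le_{\mathsf V}\omega_{\mathsf V}\to\omega_{\mathsf C}$, $(\delta\to\tau)\wedge(\delta\to\tau')\le_{\mathsf V}\delta\to(\tau\wedge\tau')$, $\delta'\le_{\mathsf V}\delta,\tau\le_{\mathsf C}\tau'\Rightarrow\delta\to\tau\le_{\mathsf V}\delta'\to\tau'$, $T\delta\wedge T\delta'\le_{\mathsf C}T(\delta\wedge\delta')$, $\delta\le_{\mathsf V}\delta'\Rightarrow T\delta\le_{\mathsf C}T\delta'$. A basis $\Gamma$ is a finite set of $x_i:\delta_i$ with distinct variables; $\Gamma(x)=\delta$ if $x:\delta\in\Gamma$, $\omega_{\mathsf V}$ otherwise; $\Gamma,x:\delta$ is extension by a new assumption. Typing rules: (Ax) $x:\delta\in\Gamma\Rightarrow\Gamma\vdash x:\delta$; ($\to$I) $\Gamma,x:\delta\vdash M:\tau\Rightarrow\Gamma\vdash\lambda x.M:\delta\to\tau$;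 (unit I) $\Gamma\vdash V:\delta\Rightarrow\Gamma\vdash\mathit{unit}\,V:T\delta$; ($\to$E) $\Gamma\vdash M:T\delta,\Gamma\vdash V:\delta\to\tau\Rightarrow\Gamma\vdash M\star V:\tau$; for each sort: ($\omega$) $\Gamma\vdash P:\omega$; ($\wedge$I) $\Gamma\vdash P:\sigma,\Gamma\vdash P:\sigma'\Rightarrow\Gamma\vdash P:\sigma\wedge\sigma'$; ($\le$) $\Gamma\vdash P:\sigma,\sigma\le\sigma'\Rightarrow\Gamma\vdash P:\sigma'$. -}

module Defs where

open import Data.Nat using (ℕ; _≟_)
open import Data.Product using (_×_; _,_; proj₁)
open import Data.List using (List; []; _∷_; map)
open import Data.List.Membership.Propositional using (_∉_)
open import Relation.Nullary using (yes; no)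

Var : Set
Var = ℕ

Atom : Set
Atom = ℕ

mutual
  data Val : Set where
    var : Var → Val
    lam : Var → Comp → Val

  data Comp : Set where
    unit : Val → Comp
    _⋆_  : Comp → Val → Comp

mutual
  data VTy : Set where
    atom : Atom → VTy
    _⇒_  : VTy → CTy → VTy
    _∧ᵛ_ : VTy → VTy → VTy
    ωᵛ   : VTy

  data CTy : Set where
    T    : VTy → CTy
    _∧ᶜ_ : CTy → CTy → CTy
    ωᶜ   : CTy

infixr 7 _∧ᵛ_ _∧ᶜ_
infixr 6 _⇒_

mutual
  data _≤V_ : VTy → VTy → Set where
    reflV   : ∀ {d} → d ≤V d
    transV  : ∀ {d d' d''} → d ≤V d' → d' ≤V d'' → d ≤V d''
    topV    : ∀ {d} → d ≤V ωᵛ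
    monoV   : ∀ {d₁ d₂ e₁ e₂} → d₁ ≤V e₁ → d₂ ≤V e₂ → (d₁ ∧ᵛ d₂) ≤V (e₁ ∧ᵛ e₂)
    idem₁V  : ∀ {d} → (d ∧ᵛ d) ≤V d
    idem₂V  : ∀ {d} → d ≤V (d ∧ᵛ d)
    commV   : ∀ {d d'} → (d ∧ᵛ d') ≤V (d' ∧ᵛ d)
    lowerV  : ∀ {d d'} → (d ∧ᵛ d') ≤V d
    glbV    : ∀ {d d' d''} → d ≤V d' → d ≤V d'' → d ≤V (d' ∧ᵛ d'')
    ω⇒ω     : ωᵛ ≤V (ωᵛ ⇒ ωᶜ)
    ⇒∧      : ∀ {d t t'} → ((d ⇒ t) ∧ᵛ (d ⇒ t')) ≤V (d ⇒ (t ∧ᶜ t'))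
    ⇒mono   : ∀ {d d' t t'} → d' ≤V d → t ≤C t' → (d ⇒ t) ≤V (d' ⇒ t')

  data _≤C_ : CTy → CTy → Set where
    reflC   : ∀ {t} → t ≤C t
    transC  : ∀ {t t' t''} → t ≤C t' → t' ≤C t'' → t ≤C t''
    topC    : ∀ {t} → t ≤C ωᶜ
    monoC   : ∀ {t₁ t₂ s₁ s₂} → t₁ ≤C s₁ → t₂ ≤C s₂ → (t₁ ∧ᶜ t₂) ≤C (s₁ ∧ᶜ s₂)
    idem₁C  : ∀ {t} → (t ∧ᶜ t) ≤C t
    idem₂C  : ∀ {t} → t ≤C (t ∧ᶜ t)
    commC   : ∀ {t t'} → (t ∧ᶜ t') ≤C (t' ∧ᶜ t)
    lowerC  : ∀ {t t'} → (t ∧ᶜ t') ≤C t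
    glbC    : ∀ {t t' t''} → t ≤C t' → t ≤C t'' → t ≤C (t' ∧ᶜ t'')
    T∧      : ∀ {d d'} → (T d ∧ᶜ T d') ≤C T (d ∧ᵛ d')
    Tmono   : ∀ {d d'} → d ≤V d' → T d ≤C T d'

Basis : Set
Basis = List (Var × VTy)

dom : Basis → List Var
dom = map proj₁

-- Γ(x): the type assigned to x, or ωᵛ if x is not in the domain.
lookupB : Basis → Var → VTy
lookupB [] x = ωᵛ
lookupB ((y , d) ∷ Γ) x with x ≟ y
... | yes _ = d
... | no  _ = lookupB Γ x

data _∶_∈B_ : Var → VTy → Basis → Set where
  here  : ∀ {x d Γ} → x ∶ d ∈B ((x , d) ∷ Γ)
  there : ∀ {x d y e Γ} → x ∶ d ∈B Γ → x ∶ d ∈B ((y , e) ∷ Γ)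

-- Γ , x : δ  (only used when x ∉ dom Γ, i.e. a new assumption)
_,,_∶_ : Basis → Var → VTy → Basis
Γ ,, x ∶ d = (x , d) ∷ Γ

mutual
  data _⊢ᵛ_∶_ (Γ : Basis) : Val → VTy → Set where
    Ax   : ∀ {x d} → x ∶ d ∈B Γ → Γ ⊢ᵛ var x ∶ d
    ⇒I   : ∀ {x M d t} → x ∉ dom Γ → (Γ ,, x ∶ d) ⊢ᶜ M ∶ t → Γ ⊢ᵛ lam x M ∶ (d ⇒ t)
    ωIᵛ  : ∀ {V} → Γ ⊢ᵛ V ∶ ωᵛ
    ∧Iᵛ  : ∀ {V d d'} → Γ ⊢ᵛ V ∶ d → Γ ⊢ᵛ V ∶ d' → Γ ⊢ᵛ V ∶ (d ∧ᵛ d')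
    ≤ᵛ   : ∀ {V d d'} → Γ ⊢ᵛ V ∶ d → d ≤V d' → Γ ⊢ᵛ V ∶ d'

  data _⊢ᶜ_∶_ (Γ : Basis) : Comp → CTy → Set where
    unitI : ∀ {V d} → Γ ⊢ᵛ V ∶ d → Γ ⊢ᶜ unit V ∶ T d
    ⇒E    : ∀ {M V d t} → Γ ⊢ᶜ M ∶ T d → Γ ⊢ᵛ V ∶ (d ⇒ t) → Γ ⊢ᶜ (M ⋆ V) ∶ t
    ωIᶜ   : ∀ {M} → Γ ⊢ᶜ M ∶ ωᶜ
    ∧Iᶜ   : ∀ {M t t'} → Γ ⊢ᶜ M ∶ t → Γ ⊢ᶜ M ∶ t' → Γ ⊢ᶜ M ∶ (t ∧ᶜ t')
    ≤ᶜ    : ∀ {M t t'} → Γ ⊢ᶜ M ∶ t → t ≤C t' → Γ ⊢ᶜ M ∶ t'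

⋀ᵛ : List VTy → VTy
⋀ᵛ [] = ωᵛ
⋀ᵛ (d ∷ []) = d
⋀ᵛ (d ∷ d' ∷ ds) = d ∧ᵛ ⋀ᵛ (d' ∷ ds)

⋀ᶜ : List CTy → CTy
⋀ᶜ [] = ωᶜ
⋀ᶜ (t ∷ []) = t
⋀ᶜ (t ∷ t' ∷ ts) = t ∧ᶜ ⋀ᶜ (t' ∷ ts)

-- Only one syntax-directed rule can end a derivation of a
-- given term; the other possible last rules are (ω), (∧I) and (≤), and these
-- are absorbed by recording a finite family of premises: (ω) gives the empty
-- family, whose intersection is ω, (∧I) concatenates two families, and (≤)
-- composes with the comparison obtained so far.
module Submission where

open import Defs
open import Data.Product using (_×_; _,_; Σ; ∃; proj₁; proj₂)
open import Data.List using (List; []; _∷_; _++_; map)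
open import Data.List.Properties using (map-++)
open import Data.List.Relation.Unary.All as All using (All; []; _∷_)
open import Data.List.Relation.Unary.All.Properties using (++⁺)
open import Data.List.Relation.Unary.AllPairs using (_∷_)
open import Data.List.Relation.Unary.Unique.Propositional using (Unique)
open import Data.List.Membership.Propositional using (_∈_; _∉_)
open import Data.List.Relation.Unary.Any using (here; there)
open import Data.Nat using (_≟_)
open import Data.Empty using (⊥-elim)
open import Relation.Nullary using (yes; no)
open import Relation.Binary.PropositionalEquality using (_≡_; _≢_; refl; sym)

∈B⇒∈dom : ∀ {x d Γ} → x ∶ d ∈B Γ → x ∈ dom Γ
∈B⇒∈dom here      = here refl
∈B⇒∈dom (there m) = there (∈B⇒∈dom m)

lookupB-∈B : ∀ {x d Γ} → Unique (dom Γ) → x ∶ d ∈B Γ → lookupB Γ x ≡ d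
lookupB-∈B {x} _ here with x ≟ x
... | yes _  = refl
... | no x≢x = ⊥-elim (x≢x refl)
lookupB-∈B {x} {Γ = (y , _) ∷ _} (y∉Γ ∷ u) (there m) with x ≟ y
... | yes x≡y = ⊥-elim (All.lookup y∉Γ (∈B⇒∈dom m) (sym x≡y))
... | no _    = lookupB-∈B u m

⋀ᵛ-++-≤ˡ : ∀ ds es → ⋀ᵛ (ds ++ es) ≤V ⋀ᵛ ds
⋀ᵛ-++-≤ˡ []            es       = topV
⋀ᵛ-++-≤ˡ (d ∷ [])      []       = reflV
⋀ᵛ-++-≤ˡ (d ∷ [])      (_ ∷ _)  = lowerV
⋀ᵛ-++-≤ˡ (d ∷ d' ∷ ds) es       = monoV reflV (⋀ᵛ-++-≤ˡ (d' ∷ ds) es)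

⋀ᵛ-++-≤ʳ : ∀ ds es → ⋀ᵛ (ds ++ es) ≤V ⋀ᵛ es
⋀ᵛ-++-≤ʳ []            es       = reflV
⋀ᵛ-++-≤ʳ (d ∷ [])      []       = topV
⋀ᵛ-++-≤ʳ (d ∷ [])      (_ ∷ _)  = transV commV lowerV
⋀ᵛ-++-≤ʳ (d ∷ d' ∷ ds) es       = transV (transV commV lowerV) (⋀ᵛ-++-≤ʳ (d' ∷ ds) es)

⋀ᶜ-++-≤ˡ : ∀ ts ss → ⋀ᶜ (ts ++ ss) ≤C ⋀ᶜ ts
⋀ᶜ-++-≤ˡ []            ss       = topC
⋀ᶜ-++-≤ˡ (t ∷ [])      []       = reflC
⋀ᶜ-++-≤ˡ (t ∷ [])      (_ ∷ _)  = lowerC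
⋀ᶜ-++-≤ˡ (t ∷ t' ∷ ts) ss       = monoC reflC (⋀ᶜ-++-≤ˡ (t' ∷ ts) ss)

⋀ᶜ-++-≤ʳ : ∀ ts ss → ⋀ᶜ (ts ++ ss) ≤C ⋀ᶜ ss
⋀ᶜ-++-≤ʳ []            ss       = reflC
⋀ᶜ-++-≤ʳ (t ∷ [])      []       = topC
⋀ᶜ-++-≤ʳ (t ∷ [])      (_ ∷ _)  = transC commC lowerC
⋀ᶜ-++-≤ʳ (t ∷ t' ∷ ts) ss       = transC (transC commC lowerC) (⋀ᶜ-++-≤ʳ (t' ∷ ts) ss)

⋀ᵛ-map-++ : ∀ {A : Set} (f : A → VTy) xs ys →
            ⋀ᵛ (map f (xs ++ ys)) ≤V (⋀ᵛ (map f xs) ∧ᵛ ⋀ᵛ (map f ys))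
⋀ᵛ-map-++ f xs ys rewrite map-++ f xs ys =
  glbV (⋀ᵛ-++-≤ˡ (map f xs) (map f ys)) (⋀ᵛ-++-≤ʳ (map f xs) (map f ys))

⋀ᶜ-map-++ : ∀ {A : Set} (f : A → CTy) xs ys →
            ⋀ᶜ (map f (xs ++ ys)) ≤C (⋀ᶜ (map f xs) ∧ᶜ ⋀ᶜ (map f ys))
⋀ᶜ-map-++ f xs ys rewrite map-++ f xs ys =
  glbC (⋀ᶜ-++-≤ˡ (map f xs) (map f ys)) (⋀ᶜ-++-≤ʳ (map f xs) (map f ys))

arrow : VTy × CTy → VTy
arrow (d , t) = d ⇒ t

var-inversion : ∀ {Γ x δ} → Unique (dom Γ) → Γ ⊢ᵛ var x ∶ δ → lookupB Γ x ≤V δ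
var-inversion u (Ax m) rewrite lookupB-∈B u m = reflV
var-inversion u ωIᵛ        = topV
var-inversion u (∧Iᵛ D E)  = glbV (var-inversion u D) (var-inversion u E)
var-inversion u (≤ᵛ D d≤)  = transV (var-inversion u D) d≤

lam-inversion : ∀ {Γ x M δ} → Γ ⊢ᵛ lam x M ∶ δ →
  Σ (List (VTy × CTy)) λ I →
    All (λ p → (x ∉ dom Γ) × ((Γ ,, x ∶ proj₁ p) ⊢ᶜ M ∶ proj₂ p)) I
    × (⋀ᵛ (map arrow I) ≤V δ)
lam-inversion (⇒I {d = d} {t} x∉Γ D) = (d , t) ∷ [] , (x∉Γ , D) ∷ [] , reflV
lam-inversion ωIᵛ = [] , [] , reflV
lam-inversion (∧Iᵛ D E) with lam-inversion D | lam-inversion E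
... | I , PI , I≤ | J , PJ , J≤ =
  I ++ J , ++⁺ PI PJ , transV (⋀ᵛ-map-++ arrow I J) (monoV I≤ J≤)
lam-inversion (≤ᵛ D d≤) with lam-inversion D
... | I , PI , I≤ = I , PI , transV I≤ d≤

unit-inversion : ∀ {Γ V τ} → Γ ⊢ᶜ unit V ∶ τ → ∃ λ δ' → (Γ ⊢ᵛ V ∶ δ') × (T δ' ≤C τ)
unit-inversion (unitI {d = d} D) = d , D , reflC
unit-inversion ωIᶜ = ωᵛ , ωIᵛ , topC
unit-inversion (∧Iᶜ D E) with unit-inversion D | unit-inversion E
... | d , Dd , d≤ | e , De , e≤ =
  d ∧ᵛ e , ∧Iᵛ Dd De , glbC (transC (Tmono lowerV) d≤) (transC (Tmono (transV commV lowerV)) e≤)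
unit-inversion (≤ᶜ D t≤) with unit-inversion D
... | d , Dd , d≤ = d , Dd , transC d≤ t≤

⋆-inversion : ∀ {Γ M V τ} → Γ ⊢ᶜ (M ⋆ V) ∶ τ →
  Σ (List (VTy × CTy)) λ I →
    All (λ p → (Γ ⊢ᶜ M ∶ T (proj₁ p)) × (Γ ⊢ᵛ V ∶ (proj₁ p ⇒ proj₂ p))) I
    × (⋀ᶜ (map proj₂ I) ≤C τ)
⋆-inversion (⇒E {d = d} {t} DM DV) = (d , t) ∷ [] , (DM , DV) ∷ [] , reflC
⋆-inversion ωIᶜ = [] , [] , reflC
⋆-inversion (∧Iᶜ D E) with ⋆-inversion D | ⋆-inversion E
... | I , PI , I≤ | J , PJ , J≤ =
  I ++ J , ++⁺ PI PJ , transC (⋀ᶜ-map-++ proj₂ I J) (monoC I≤ J≤)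
⋆-inversion (≤ᶜ D t≤) with ⋆-inversion D
... | I , PI , I≤ = I , PI , transC I≤ t≤

mainTheorem9 : (Γ : Basis) → Unique (dom Γ) → (δ : VTy) → (τ : CTy) → δ ≢ ωᵛ → τ ≢ ωᶜ →
    ((x : Var) → Γ ⊢ᵛ var x ∶ δ → lookupB Γ x ≤V δ)
    × ((x : Var) (M : Comp) → Γ ⊢ᵛ lam x M ∶ δ →
        Σ (List (VTy × CTy)) λ I →
          All (λ p → (x ∉ dom Γ) × ((Γ ,, x ∶ proj₁ p) ⊢ᶜ M ∶ proj₂ p)) I
          × (⋀ᵛ (map (λ p → proj₁ p ⇒ proj₂ p) I) ≤V δ))
    × ((V : Val) → Γ ⊢ᶜ unit V ∶ τ → ∃ λ δ' → (Γ ⊢ᵛ V ∶ δ') × (T δ' ≤C τ))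
    × ((M : Comp) (V : Val) → Γ ⊢ᶜ (M ⋆ V) ∶ τ →
        Σ (List (VTy × CTy)) λ I →
          All (λ p → (Γ ⊢ᶜ M ∶ T (proj₁ p)) × (Γ ⊢ᵛ V ∶ (proj₁ p ⇒ proj₂ p))) I
          × (⋀ᶜ (map proj₂ I) ≤C τ))
mainTheorem9 Γ unique δ τ _ _ =
    (λ _ → var-inversion unique)
  , (λ _ _ → lam-inversion)
  , (λ _ → unit-inversion)
  , (λ _ _ → ⋆-inversion)
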